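{- Let $I=(G=(V,E),s,t,\beta,\lambda)$ be an instance of \textsc{Length-Bounded Cut} where $G$ is an interval graph with interval representation $v\mapsto[b_v,e_v]$ satisfying $b_s<b_t$. Let $L=\{u\in V\mid e_u<b_s\}$ and $R=\{u\in V\mid e_t<b_u\}$. Then $I'=(G[V\setminus(L\cup R)],s,t,\beta,\lambda)$ is an equivalent instance of \textsc{Length-Bounded Cut}, i.e., $I$ is a yes-instance if and only if $I'$ is a yes-instance.
   Context: \textsc{Length-Bounded Cut}: given an undirected graph $G=(V,E)$, two vertices $s,t$, and positive integers $\beta,\lambda$, decide whether there is $F\subseteq E$ with $|F|\le\beta$ such that $G-F$ contains no $s$-$t$-path of length (number of edges) at most $\lambda$. An interval graph is a graph with an interval representation assigning to each vertex $v$ an interval $[b_v,e_v]$ such that two vertices are adjacent iff their intervals intersect. $G[X]$ denotes the subgraph induced by $X$. -}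

module Defs where

open import Data.Nat using (ℕ; suc; _<_) renaming (_≤_ to _≤ℕ_)
open import Data.Fin using (Fin; toℕ)
open import Data.List using (List; []; _∷_; length)
open import Data.List.Membership.Propositional using (_∈_)
open import Data.List.Relation.Unary.All using (All)
open import Data.List.Relation.Unary.Unique.Propositional using (Unique)
open import Data.Product using (Σ; ∃; _×_; _,_)
open import Data.Sum using (_⊎_)
open import Data.Unit using (⊤)
open import Relation.Nullary using (¬_)
open import Relation.Binary.PropositionalEquality using (_≢_)
open import Data.Rational using (ℚ) renaming (_≤_ to _≤ℚ_; _<_ to _<ℚ_)

-- A (simple, undirected) graph whose vertex set is a subset V of Fin n,
-- with adjacency relation Adj (assumed symmetric/irreflexive for the graphs we build).
record Graph (n : ℕ) : Set₁ where
  field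
    V   : Fin n → Set
    Adj : Fin n → Fin n → Set
open Graph public

induced : ∀ {n} → Graph n → (Fin n → Set) → Graph n
induced G X = record
  { V   = λ v → V G v × X v
  ; Adj = λ u v → X u × X v × Adj G u v }

Intersect : ∀ {n} → (b e : Fin n → ℚ) → Fin n → Fin n → Set
Intersect b e u v = (b u ≤ℚ e v) × (b v ≤ℚ e u)

intervalGraph : ∀ {n} → (b e : Fin n → ℚ) → Graph n
intervalGraph b e = record
  { V   = λ _ → ⊤
  ; Adj = λ u v → (u ≢ v) × Intersect b e u v }

-- An edge set F is a list of ordered pairs (u , v) with toℕ u < toℕ v,
-- each an edge of G, without duplicates; so length F = |F|.
IsEdgeSet : ∀ {n} → Graph n → List (Fin n × Fin n) → Set
IsEdgeSet G F = All (λ { (u , v) → Adj G u v × (toℕ u < toℕ v) }) F × Unique F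

Deleted : ∀ {n} → List (Fin n × Fin n) → Fin n → Fin n → Set
Deleted F u v = ((u , v) ∈ F) ⊎ ((v , u) ∈ F)

data Walk {n : ℕ} (G : Graph n) (F : List (Fin n × Fin n)) :
          Fin n → Fin n → List (Fin n) → Set where
  here : ∀ {u} → V G u → Walk G F u u (u ∷ [])
  step : ∀ {u v w p} → V G u → Adj G u v → ¬ Deleted F u v →
         Walk G F v w p → Walk G F u w (u ∷ p)

-- G - F contains an s-t path (no repeated vertex) with at most ℓ edges
ShortPath : ∀ {n} → Graph n → List (Fin n × Fin n) → Fin n → Fin n → ℕ → Set
ShortPath G F s t ℓ =
  Σ (List _) λ p → Walk G F s t p × Unique p × (length p ≤ℕ suc ℓ)

LBCYes : ∀ {n} → Graph n → Fin n → Fin n → ℕ → ℕ → Set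
LBCYes G s t β ℓ =
  ∃ λ F → IsEdgeSet G F × (length F ≤ℕ β) × ¬ ShortPath G F s t ℓ

InL : ∀ {n} → (b e : Fin n → ℚ) → Fin n → Fin n → Set
InL b e s u = e u <ℚ b s

InR : ∀ {n} → (b e : Fin n → ℚ) → Fin n → Fin n → Set
InR b e t u = e t <ℚ b u

-- The forward direction is general: restricting a cut of G to the edges inside
-- a vertex set X cuts G[X] ('restrict').  For the converse we add the vertices
-- back in two steps, R and then L ('restoreR', 'restoreL'), each working for any
-- induced subgraph G of the interval graph.  Given a cut F of G[V ∖ R] (resp.
-- G[V ∖ L]) we either use F itself or the star of t (resp. of s or t), which
-- always cuts; this is 'starOrCut'.  The star is chosen only when it is no larger
-- than β, so it remains to show: if some short s-t path survives in G - F, then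
-- F has at least as many edges as the star.  Such a path leaves V ∖ R (or V ∖ L)
-- ('firstExit', 'lastExit'), and its part inside covers a whole range of the line
-- ('cover').  Hence every neighbour w of the centre meets a vertex z of that part,
-- and since no short path survives in the smaller graph, either {w, centre} or
-- {z, w} lies in F ('tDegree', 'sDegree').  Charging w to that edge is injective
-- ('chargeBound'), which gives the bound.
module Submission where

open import Defs
open import Data.Nat using (ℕ; suc; z≤n; s≤s)
  renaming (_≤_ to _≤ℕ_; _<_ to _<ℕ_; _<?_ to _<ℕ?_; _≤?_ to _≤ℕ?_)
import Data.Nat.Properties as ℕP
open import Data.Fin using (Fin; toℕ; _≟_)
open import Data.Fin.Properties using (toℕ-injective)
open import Data.List using (List; []; _∷_; [_]; length; _++_; map; filter; allFin)
open import Data.List.Properties using (length-map; length-filter; length-++)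
open import Data.List.Membership.Propositional using (_∈_; _∉_; find; lose)
open import Data.List.Membership.Propositional.Properties
  using (∈-map⁺; ∈-filter⁺; ∈-filter⁻; ∈-allFin)
import Data.List.Membership.DecPropositional as DecMembership
open import Data.List.Relation.Binary.Subset.Propositional using (_⊆_)
open import Data.List.Relation.Unary.Any using (here; there; any?; _─_)
open import Data.List.Relation.Unary.All as All using (All; []; _∷_)
open import Data.List.Relation.Unary.All.Properties using (¬Any⇒All¬; map⁺)
open import Data.List.Relation.Unary.Unique.Propositional using (Unique; []; _∷_)
import Data.List.Relation.Unary.Unique.Propositional.Properties as Unique
open import Data.Product using (∃; _×_; _,_; proj₁; proj₂)
open import Data.Product.Properties using (≡-dec)
open import Data.Sum using (_⊎_; inj₁; inj₂; [_,_]′)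
open import Data.Unit using (tt)
open import Data.Empty using (⊥; ⊥-elim)
open import Function using (_∘_)
open import Function.Bundles using (_⇔_; mk⇔)
open import Relation.Nullary using (¬_; Dec; yes; no)
open import Relation.Nullary.Decidable using (_×-dec_; _⊎-dec_; ¬?; map′; decidable-stable)
open import Relation.Binary.PropositionalEquality using (_≡_; _≢_; refl; sym; trans; cong; subst)
open import Data.Rational using (ℚ) renaming (_≤_ to _≤ℚ_; _<_ to _<ℚ_)
import Data.Rational.Properties as ℚP

module _ {A : Set} where

  length-─ : ∀ {x : A} (ys : List A) (x∈ys : x ∈ ys) → length ys ≡ suc (length (ys ─ x∈ys))
  length-─ (y ∷ ys) (here _)    = refl
  length-─ (y ∷ ys) (there x∈ys) = cong suc (length-─ ys x∈ys)

  ∈-─ : ∀ {x z : A} (ys : List A) (x∈ys : x ∈ ys) → z ∈ ys → x ≢ z → z ∈ (ys ─ x∈ys)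
  ∈-─ (y ∷ ys) (here refl)  (here refl)  x≢z = ⊥-elim (x≢z refl)
  ∈-─ (y ∷ ys) (here refl)  (there z∈ys) x≢z = z∈ys
  ∈-─ (y ∷ ys) (there x∈ys) (here refl)  x≢z = here refl
  ∈-─ (y ∷ ys) (there x∈ys) (there z∈ys) x≢z = there (∈-─ ys x∈ys z∈ys x≢z)

  unique⊆⇒length≤ : ∀ {xs ys : List A} → Unique xs → xs ⊆ ys → length xs ≤ℕ length ys
  unique⊆⇒length≤ {[]}     _                  _     = z≤n
  unique⊆⇒length≤ {x ∷ xs} {ys} (x∉xs ∷ xs-unique) xs⊆ys =
    subst (suc (length xs) ≤ℕ_) (sym (length-─ ys x∈ys))
      (s≤s (unique⊆⇒length≤ xs-unique
        (λ z∈xs → ∈-─ ys x∈ys (xs⊆ys (there z∈xs)) (All.lookup x∉xs z∈xs))))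
    where
    x∈ys : x ∈ ys
    x∈ys = xs⊆ys (here refl)

module _ {n : ℕ} where

  deleted-sym : ∀ {F : List (Fin n × Fin n)} {u v} → Deleted F u v → Deleted F v u
  deleted-sym (inj₁ uv∈F) = inj₂ uv∈F
  deleted-sym (inj₂ vu∈F) = inj₁ vu∈F

  deleted? : ∀ (F : List (Fin n × Fin n)) u v → Dec (Deleted F u v)
  deleted? F u v = ((u , v) ∈? F) ⊎-dec ((v , u) ∈? F)
    where open DecMembership (≡-dec _≟_ _≟_) using (_∈?_)

-- Each edge of F pays for at most one vertex, namely its
-- 'owner', so F must be at least as long as any duplicate-free list of paid-for
-- vertices different from c.
module Charge {n : ℕ} (F : List (Fin n × Fin n)) (c : Fin n) (q : List (Fin n)) where
  open DecMembership (_≟_ {n}) using (_∈?_)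

  PaidFor : Fin n → Set
  PaidFor w = Deleted F w c ⊎ (w ∉ q × ∃ λ z → z ∈ q × Deleted F z w)

  paidFor : ∀ {w z} → z ∈ q →
            (w ∈ q → ¬ Deleted F w c → ⊥) →
            (w ∉ q → ¬ Deleted F w c → ¬ Deleted F z w → ⊥) → PaidFor w
  paidFor {w} {z} z∈q on-q off-q with deleted? F w c
  ... | yes wc-deleted = inj₁ wc-deleted
  ... | no wc-kept with w ∈? q
  ...   | yes w∈q = ⊥-elim (on-q w∈q wc-kept)
  ...   | no w∉q with deleted? F z w
  ...     | yes zw-deleted = inj₂ (w∉q , z , z∈q , zw-deleted)
  ...     | no zw-kept = ⊥-elim (off-q w∉q wc-kept zw-kept)

  owner : Fin n × Fin n → Fin n
  owner (a , a′) with a ≟ c | a′ ≟ c | a ∈? q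
  ... | yes _ | _     | _     = a′
  ... | no _  | yes _ | _     = a
  ... | no _  | no _  | yes _ = a′
  ... | no _  | no _  | no _  = a

  -- Each of the four ways PaidFor w can arise produces an edge owned by w.
  owner-centreˡ : ∀ {w} → owner (c , w) ≡ w
  owner-centreˡ {w} with c ≟ c | w ≟ c | c ∈? q
  ... | yes _  | _ | _ = refl
  ... | no c≢c | _ | _ = ⊥-elim (c≢c refl)

  owner-centreʳ : ∀ {w} → w ≢ c → owner (w , c) ≡ w
  owner-centreʳ {w} w≢c with w ≟ c | c ≟ c | w ∈? q
  ... | yes w≡c | _      | _ = ⊥-elim (w≢c w≡c)
  ... | no _    | yes _  | _ = refl
  ... | no _    | no c≢c | _ = ⊥-elim (c≢c refl)

  owner-fromq : ∀ {z w} → z ∈ q → w ≢ c → owner (z , w) ≡ w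
  owner-fromq {z} {w} z∈q w≢c with z ≟ c | w ≟ c | z ∈? q
  ... | yes _ | _       | _        = refl
  ... | no _  | yes w≡c | _        = ⊥-elim (w≢c w≡c)
  ... | no _  | no _    | yes _    = refl
  ... | no _  | no _    | no z∉q   = ⊥-elim (z∉q z∈q)

  owner-toq : ∀ {z w} → w ∉ q → w ≢ c → owner (w , z) ≡ w
  owner-toq {z} {w} w∉q w≢c with w ≟ c | z ≟ c | w ∈? q
  ... | yes w≡c | _     | _        = ⊥-elim (w≢c w≡c)
  ... | no _    | yes _ | _        = refl
  ... | no _    | no _  | yes w∈q  = ⊥-elim (w∉q w∈q)
  ... | no _    | no _  | no _     = refl

  chargeBound : (N : List (Fin n)) → Unique N → (∀ {w} → w ∈ N → w ≢ c) →
                (∀ {w} → w ∈ N → PaidFor w) → length N ≤ℕ length F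
  chargeBound N N-unique N≢c N-paid =
    subst (length N ≤ℕ_) (length-map owner F) (unique⊆⇒length≤ N-unique N⊆owners)
    where
    owned : ∀ {uv w} → uv ∈ F → owner uv ≡ w → w ∈ map owner F
    owned uv∈F refl = ∈-map⁺ owner uv∈F

    N⊆owners : N ⊆ map owner F
    N⊆owners w∈N with N-paid w∈N
    ... | inj₁ (inj₁ wc∈F)               = owned wc∈F (owner-centreʳ (N≢c w∈N))
    ... | inj₁ (inj₂ cw∈F)               = owned cw∈F owner-centreˡ
    ... | inj₂ (w∉q , z , z∈q , inj₁ zw∈F) = owned zw∈F (owner-fromq z∈q (N≢c w∈N))
    ... | inj₂ (w∉q , z , z∈q , inj₂ wz∈F) = owned wz∈F (owner-toq w∉q (N≢c w∈N))

length-snoc : ∀ {A : Set} (p : List A) (x : A) → length (p ++ [ x ]) ≡ suc (length p)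
length-snoc p x = trans (length-++ p) (ℕP.+-comm (length p) 1)

module _ {n : ℕ} {G : Graph n} {F : List (Fin n × Fin n)} where
  open DecMembership (_≟_ {n}) using (_∈?_)

  walk-V : ∀ {u w p x} → Walk G F u w p → x ∈ p → V G x
  walk-V (here vu)       (here refl) = vu
  walk-V (step vu _ _ _) (here refl) = vu
  walk-V (step _ _ _ W)  (there x∈p) = walk-V W x∈p

  start∈ : ∀ {u w p} → Walk G F u w p → u ∈ p
  start∈ (here _)       = here refl
  start∈ (step _ _ _ _) = here refl

  nonempty : ∀ {u w p} → Walk G F u w p → 1 ≤ℕ length p
  nonempty (here _)       = s≤s z≤n
  nonempty (step _ _ _ _) = s≤s z≤n

  twoVertices : ∀ {u w p} → u ≢ w → Walk G F u w p → 2 ≤ℕ length p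
  twoVertices u≢w (here _)       = ⊥-elim (u≢w refl)
  twoVertices _   (step _ _ _ W) = s≤s (nonempty W)

  snoc : ∀ {u v w p} → Walk G F u v p → V G w → Adj G v w → ¬ Deleted F v w →
         Walk G F u w (p ++ [ w ])
  snoc (here vu)          vw vw-adj vw-kept = step vu vw-adj vw-kept (here vw)
  snoc (step vu a kept W) vw vw-adj vw-kept = step vu a kept (snoc W vw vw-adj vw-kept)

  prefix : ∀ {u w p x} → Walk G F u w p → x ∈ p →
           ∃ λ r → Walk G F u x r × length r ≤ℕ length p
  prefix (here vu)       (here refl) = _ , here vu , ℕP.≤-refl
  prefix (step vu _ _ _) (here refl) = _ , here vu , s≤s z≤n
  prefix (step vu a kept W) (there x∈p) with prefix W x∈p
  ... | r , Wr , r≤p = _ , step vu a kept Wr , s≤s r≤p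

  suffix : ∀ {u w p x} → Walk G F u w p → x ∈ p →
           ∃ λ r → Walk G F x w r × length r ≤ℕ length p × (Unique p → Unique r)
  suffix W@(here _)       (here refl) = _ , W , ℕP.≤-refl , λ p-unique → p-unique
  suffix W@(step _ _ _ _) (here refl) = _ , W , ℕP.≤-refl , λ p-unique → p-unique
  suffix (step _ _ _ W)   (there x∈p) with suffix W x∈p
  ... | r , Wr , r≤p , unique-r =
        r , Wr , ℕP.m≤n⇒m≤1+n r≤p , λ { (_ ∷ p-unique) → unique-r p-unique }

  toPath : ∀ {u w p} → Walk G F u w p →
           ∃ λ q → Walk G F u w q × Unique q × length q ≤ℕ length p
  toPath (here vu) = _ , here vu , [] ∷ [] , ℕP.≤-refl
  toPath {u} (step vu a kept W) with toPath W
  ... | q , Wq , q-unique , q≤W with u ∈? q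
  ...   | yes u∈q with suffix Wq u∈q
  ...     | r , Wr , r≤q , unique-r =
            r , Wr , unique-r q-unique , ℕP.m≤n⇒m≤1+n (ℕP.≤-trans r≤q q≤W)
  toPath (step vu a kept W) | q , Wq , q-unique , q≤W | no u∉q =
    _ , step vu a kept Wq , ¬Any⇒All¬ q u∉q ∷ q-unique , s≤s q≤W

  walk⇒shortPath : ∀ {s t ℓ p} → Walk G F s t p → length p ≤ℕ suc ℓ → ShortPath G F s t ℓ
  walk⇒shortPath W p≤ℓ with toPath W
  ... | q , Wq , q-unique , q≤p = q , Wq , q-unique , ℕP.≤-trans q≤p p≤ℓ

restrictWalk : ∀ {n} {G : Graph n} {Z : Fin n → Set} {F u w p} →
               All Z p → Walk G F u w p → Walk (induced G Z) F u w p
restrictWalk (zu ∷ [])  (here vu) = here (vu , zu)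
restrictWalk (zu ∷ zp)  (step vu a kept W) =
  step (vu , zu) (zu , All.lookup zp (start∈ W) , a) kept (restrictWalk zp W)

edgeSet-induced : ∀ {n} {G : Graph n} {Z : Fin n → Set} {F} → IsEdgeSet (induced G Z) F → IsEdgeSet G F
edgeSet-induced (F-valid , F-unique) =
  All.map (λ ((_ , _ , a) , ordered) → a , ordered) F-valid , F-unique

transfer : ∀ {n} (G₁ G₂ : Graph n) {s t β ℓ} →
           (∀ {u} → V G₁ u → V G₂ u) → (∀ {u} → V G₂ u → V G₁ u) →
           (∀ {u v} → Adj G₁ u v → Adj G₂ u v) → (∀ {u v} → Adj G₂ u v → Adj G₁ u v) →
           LBCYes G₁ s t β ℓ → LBCYes G₂ s t β ℓ
transfer G₁ G₂ V₁⇒V₂ V₂⇒V₁ adj₁⇒adj₂ adj₂⇒adj₁ (F , (F-valid , F-unique) , F≤β , F-cuts) =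
  F , (All.map (λ (a , ordered) → adj₁⇒adj₂ a , ordered) F-valid , F-unique) , F≤β ,
  λ (p , W , p-unique , p≤ℓ) → F-cuts (p , back W , p-unique , p≤ℓ)
  where
  back : ∀ {F u w p} → Walk G₂ F u w p → Walk G₁ F u w p
  back (here vu)          = here (V₂⇒V₁ vu)
  back (step vu a kept W) = step (V₂⇒V₁ vu) (adj₂⇒adj₁ a) kept (back W)

restrict : ∀ {n} (G : Graph n) {Z : Fin n → Set} → (∀ u → Dec (Z u)) → ∀ {s t β ℓ} →
           LBCYes G s t β ℓ → LBCYes (induced G Z) s t β ℓ
restrict {n} G {Z} Z? (F , (F-valid , F-unique) , F≤β , F-cuts) =
  F′ , (All.tabulate valid , Unique.filter⁺ inside? F-unique) ,
  ℕP.≤-trans (length-filter inside? F) F≤β ,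
  λ (p , W , p-unique , p≤ℓ) → F-cuts (p , lift W , p-unique , p≤ℓ)
  where
  inside? : ∀ (uv : Fin n × Fin n) → Dec (Z (proj₁ uv) × Z (proj₂ uv))
  inside? (u , v) = Z? u ×-dec Z? v

  F′ : List (Fin n × Fin n)
  F′ = filter inside? F

  valid : ∀ {uv} → uv ∈ F′ →
          Adj (induced G Z) (proj₁ uv) (proj₂ uv) × (toℕ (proj₁ uv) <ℕ toℕ (proj₂ uv))
  valid uv∈F′ with ∈-filter⁻ inside? {xs = F} uv∈F′
  ... | uv∈F , (zu , zv) with All.lookup F-valid uv∈F
  ...   | a , ordered = (zu , zv , a) , ordered

  lift : ∀ {u w p} → Walk (induced G Z) F′ u w p → Walk G F u w p
  lift (here (vu , _)) = here vu
  lift (step (vu , _) (zu , zv , a) kept W) = step vu a kept′ (lift W)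
    where
    kept′ : ¬ Deleted F _ _
    kept′ (inj₁ uv∈F) = kept (inj₁ (∈-filter⁺ inside? uv∈F (zu , zv)))
    kept′ (inj₂ vu∈F) = kept (inj₂ (∈-filter⁺ inside? vu∈F (zv , zu)))

module _ {n : ℕ} {G : Graph n} {Z : Fin n → Set} (Z? : ∀ u → Dec (Z u))
         {F : List (Fin n × Fin n)} where

  firstExit : ∀ {u w p} → Z u → Z w → Walk G F u w p →
    Walk (induced G Z) F u w p ⊎
    (∃ λ x → ∃ λ r → ∃ λ q → Walk (induced G Z) F u x q × ¬ Z r × Adj G x r ×
                               suc (suc (length q)) ≤ℕ length p)
  firstExit zu zw (here vu) = inj₁ (here (vu , zu))
  firstExit {u} zu zw (step {v = v} vu a kept W) with Z? v
  ... | no ¬zv =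
    inj₂ (u , v , _ , here (vu , zu) , ¬zv , a , s≤s (twoVertices (λ { refl → ¬zv zw }) W))
  ... | yes zv with firstExit zv zw W
  ...   | inj₁ W′ = inj₁ (step (vu , zu) (zu , zv , a) kept W′)
  ...   | inj₂ (x , r , q , Wq , ¬zr , xr , q<W) =
          inj₂ (x , r , _ , step (vu , zu) (zu , zv , a) kept Wq , ¬zr , xr , s≤s q<W)

  lastExitTail : ∀ {u w p} → Z w → Walk G F u w p →
    All Z p ⊎
    (∃ λ u′ → ∃ λ y → ∃ λ q → ¬ Z u′ × Adj G u′ y × Walk (induced G Z) F y w q ×
                                suc (length q) ≤ℕ length p)
  lastExitTail zw (here _) = inj₁ (zw ∷ [])
  lastExitTail zw (step {u = u} {v = v} vu a kept W) with lastExitTail zw W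
  ... | inj₂ (u′ , y , q , ¬zu′ , u′y , Wq , q<W) =
        inj₂ (u′ , y , q , ¬zu′ , u′y , Wq , ℕP.m≤n⇒m≤1+n q<W)
  ... | inj₁ zW with Z? u
  ...   | yes zu = inj₁ (zu ∷ zW)
  ...   | no ¬zu = inj₂ (u , v , _ , ¬zu , a , restrictWalk zW W , ℕP.≤-refl)

  lastExit : ∀ {u w p} → Z u → Z w → Walk G F u w p →
    Walk (induced G Z) F u w p ⊎
    (∃ λ u′ → ∃ λ y → ∃ λ q → ¬ Z u′ × Adj G u′ y × Walk (induced G Z) F y w q ×
                                suc (suc (length q)) ≤ℕ length p)
  lastExit zu zw (here vu) = inj₁ (here (vu , zu))
  lastExit zu zw (step vu a kept W) with lastExitTail zw W
  ... | inj₁ zW = inj₁ (restrictWalk (zu ∷ zW) (step vu a kept W))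
  ... | inj₂ (u′ , y , q , ¬zu′ , u′y , Wq , q<W) = inj₂ (u′ , y , q , ¬zu′ , u′y , Wq , s≤s q<W)

module Stars {n : ℕ} (G : Graph n) (adj? : ∀ u v → Dec (Adj G u v))
             (adj-sym : ∀ {u v} → Adj G u v → Adj G v u)
             (adj-irrefl : ∀ {u v} → Adj G u v → u ≢ v) where

  nbrs : Fin n → List (Fin n)
  nbrs c = filter (adj? c) (allFin n)

  nbrs-unique : ∀ c → Unique (nbrs c)
  nbrs-unique c = Unique.filter⁺ (adj? c) (Unique.allFin⁺ n)

  ∈nbrs⇒adj : ∀ {c w} → w ∈ nbrs c → Adj G c w
  ∈nbrs⇒adj {c} w∈N = proj₂ (∈-filter⁻ (adj? c) {xs = allFin n} w∈N)

  orient : Fin n → Fin n → Fin n × Fin n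
  orient c w with toℕ c <ℕ? toℕ w
  ... | yes _ = c , w
  ... | no _  = w , c

  orient-injective : ∀ {c w w′} → orient c w ≡ orient c w′ → w ≡ w′
  orient-injective {c} {w} {w′} eq with toℕ c <ℕ? toℕ w | toℕ c <ℕ? toℕ w′
  orient-injective refl | yes _ | yes _ = refl
  orient-injective refl | yes _ | no _  = refl
  orient-injective refl | no _  | yes _ = refl
  orient-injective refl | no _  | no _  = refl

  orient-valid : ∀ {c w} → Adj G c w →
    Adj G (proj₁ (orient c w)) (proj₂ (orient c w)) × (toℕ (proj₁ (orient c w)) <ℕ toℕ (proj₂ (orient c w)))
  orient-valid {c} {w} cw with toℕ c <ℕ? toℕ w
  ... | yes c<w = cw , c<w
  ... | no c≮w  = adj-sym cw , ℕP.≤∧≢⇒< (ℕP.≮⇒≥ c≮w) (λ w≡c → adj-irrefl cw (toℕ-injective (sym w≡c)))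

  star : Fin n → List (Fin n × Fin n)
  star c = map (orient c) (nbrs c)

  star-edgeSet : ∀ c → IsEdgeSet G (star c)
  star-edgeSet c =
    map⁺ (All.tabulate (λ w∈N → orient-valid (∈nbrs⇒adj w∈N))) ,
    Unique.map⁺ orient-injective (nbrs-unique c)

  star-deletes : ∀ {c w} → Adj G c w → Deleted (star c) c w
  star-deletes {c} {w} cw with toℕ c <ℕ? toℕ w | ∈-map⁺ (orient c) (∈-filter⁺ (adj? c) (∈-allFin w) cw)
  ... | yes _ | cw∈star = inj₁ cw∈star
  ... | no _  | wc∈star = inj₂ wc∈star

  noWalkInto : ∀ {c u p} → Walk G (star c) u c p → u ≢ c → ⊥
  noWalkInto (here _) u≢c = u≢c refl
  noWalkInto {c} (step {v = v} _ uv kept W) u≢c with v ≟ c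
  ... | yes refl = kept (deleted-sym (star-deletes (adj-sym uv)))
  ... | no v≢c   = noWalkInto W v≢c

  noWalkOut : ∀ {c w p} → Walk G (star c) c w p → c ≢ w → ⊥
  noWalkOut (here _)          c≢w = c≢w refl
  noWalkOut (step _ cv kept _) _  = kept (star-deletes cv)

  starOrCut : ∀ {s t β ℓ} → s ≢ t → (F : List (Fin n × Fin n)) → IsEdgeSet G F → length F ≤ℕ β →
    (ShortPath G F s t ℓ → length (nbrs s) ≤ℕ length F ⊎ length (nbrs t) ≤ℕ length F) →
    LBCYes G s t β ℓ
  starOrCut {s} {t} {β} s≢t F F-edges F≤β degree-bound
    with length (nbrs s) ≤ℕ? β | length (nbrs t) ≤ℕ? β
  ... | yes small | _ =
    star s , star-edgeSet s , subst (_≤ℕ β) (sym (length-map _ (nbrs s))) small ,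
    λ (_ , W , _) → noWalkOut W s≢t
  ... | no _ | yes small =
    star t , star-edgeSet t , subst (_≤ℕ β) (sym (length-map _ (nbrs t))) small ,
    λ (_ , W , _) → noWalkInto W s≢t
  ... | no large-s | no large-t =
    F , F-edges , F≤β ,
    λ P → [ (λ s≤F → large-s (ℕP.≤-trans s≤F F≤β)) , (λ t≤F → large-t (ℕP.≤-trans t≤F F≤β)) ]′
            (degree-bound P)

≤⇒≯ : ∀ {x y : ℚ} → x ≤ℚ y → ¬ (y <ℚ x)
≤⇒≯ x≤y y<x = ℚP.<-irrefl refl (ℚP.<-≤-trans y<x x≤y)

module Interval {n : ℕ} (b e : Fin n → ℚ) (b≤e : ∀ v → b v ≤ℚ e v) where

  record IntervalSubgraph (G : Graph n) : Set where
    field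
      vertex? : ∀ u → Dec (V G u)
      adj⇒    : ∀ {u v} → Adj G u v → V G u × V G v × u ≢ v × Intersect b e u v
      adj⇐    : ∀ {u v} → V G u → V G v → u ≢ v → Intersect b e u v → Adj G u v

  intervalGraph-subgraph : IntervalSubgraph (intervalGraph b e)
  intervalGraph-subgraph = record
    { vertex? = λ _ → yes tt
    ; adj⇒    = λ (u≢v , uv) → tt , tt , u≢v , uv
    ; adj⇐    = λ _ _ u≢v uv → u≢v , uv }

  induced-subgraph : ∀ {G Z} → IntervalSubgraph G → (∀ u → Dec (Z u)) →
                     IntervalSubgraph (induced G Z)
  induced-subgraph IG Z? = record
    { vertex? = λ u → vertex? u ×-dec Z? u
    ; adj⇒    = λ (zu , zv , a) → let (vu , vv , u≢v , uv) = adj⇒ a in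
                                  (vu , zu) , (vv , zv) , u≢v , uv
    ; adj⇐    = λ (vu , zu) (vv , zv) u≢v uv → zu , zv , adj⇐ vu vv u≢v uv }
    where open IntervalSubgraph IG

  module OnSubgraph {G : Graph n} (IG : IntervalSubgraph G) where
    open IntervalSubgraph IG public

    adj? : ∀ u v → Dec (Adj G u v)
    adj? u v = map′ (λ (vu , vv , u≢v , uv) → adj⇐ vu vv u≢v uv) adj⇒
      (vertex? u ×-dec vertex? v ×-dec ¬? (u ≟ v) ×-dec (b u ℚP.≤? e v ×-dec b v ℚP.≤? e u))

    adj-sym : ∀ {u v} → Adj G u v → Adj G v u
    adj-sym uv-adj = let (vu , vv , u≢v , bu≤ev , bv≤eu) = adj⇒ uv-adj in
                     adj⇐ vv vu (u≢v ∘ sym) (bv≤eu , bu≤ev)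

    adj-irrefl : ∀ {u v} → Adj G u v → u ≢ v
    adj-irrefl uv-adj = proj₁ (proj₂ (proj₂ (adj⇒ uv-adj)))

    adj⇒intersect : ∀ {u v} → Adj G u v → Intersect b e u v
    adj⇒intersect uv-adj = proj₂ (proj₂ (proj₂ (adj⇒ uv-adj)))

    open Stars G adj? adj-sym adj-irrefl public

    -- Consecutive intervals of a walk overlap, so an interval reaching from the
    -- start b a of a walk to its end e c meets an interval on the walk.
    cover : ∀ {F a c p w} → Walk G F a c p → b a ≤ℚ e w → b w ≤ℚ e c →
            ∃ λ z → z ∈ p × Intersect b e z w
    cover (here _) ba≤ew bw≤ec = _ , here refl , ba≤ew , bw≤ec
    cover {a = a} {w = w} (step {v = a′} _ aa′ _ W) ba≤ew bw≤ec with b w ℚP.≤? e a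
    ... | yes bw≤ea = a , here refl , ba≤ew , bw≤ea
    ... | no bw≰ea = let (z , z∈p , zw) = cover W ba′≤ew bw≤ec in z , there z∈p , zw
      where
      -- b a′ ≤ e a < b w ≤ e w
      ba′≤ew : b a′ ≤ℚ e w
      ba′≤ew = ℚP.<⇒≤ (ℚP.≤-<-trans (proj₂ (adj⇒intersect aa′))
                                    (ℚP.<-≤-trans (ℚP.≰⇒> bw≰ea) (b≤e w)))

    module DegreeBounds {F s t ℓ} (F-cuts : ¬ ShortPath G F s t ℓ) where

      noShortWalk : ∀ {p} → Walk G F s t p → length p ≤ℕ suc ℓ → ⊥
      noShortWalk W p≤ℓ = F-cuts (walk⇒shortPath W p≤ℓ)

      twoMore : ∀ {k m} → suc k ≤ℕ ℓ → m ≤ℕ k → suc (suc m) ≤ℕ suc ℓ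
      twoMore k<ℓ m≤k = s≤s (ℕP.≤-trans (s≤s m≤k) k<ℓ)

      -- q runs from s to an interval ending after e t: appending w, t to a prefix
      -- of q would give a short s-t walk.
      tDegree : ∀ {x q} → b s <ℚ b t → Walk G F s x q → e t ≤ℚ e x → suc (length q) ≤ℕ ℓ →
                (N : List (Fin n)) → Unique N → (∀ {w} → w ∈ N → Adj G w t) →
                length N ≤ℕ length F
      tDegree {q = q} bs<bt Wq et≤ex q<ℓ N N-unique N-adj =
        chargeBound N N-unique (λ w∈N → adj-irrefl (N-adj w∈N)) paid
        where
        open Charge F t q

        paid : ∀ {w} → w ∈ N → PaidFor w
        paid {w} w∈N with adj⇒ (N-adj w∈N)
        ... | vw , vt , _ , bw≤et , bt≤ew
          with cover Wq (ℚP.<⇒≤ (ℚP.<-≤-trans bs<bt bt≤ew)) (ℚP.≤-trans bw≤et et≤ex)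
        ...   | z , z∈q , zw = paidFor z∈q on-q off-q
          where
          on-q : w ∈ q → ¬ Deleted F w t → ⊥
          on-q w∈q wt-kept with prefix Wq w∈q
          ... | r , Wr , r≤q =
            noShortWalk (snoc Wr vt (N-adj w∈N) wt-kept)
              (subst (_≤ℕ suc ℓ) (sym (length-snoc r t)) (ℕP.m+n≤o⇒n≤o 1 (twoMore q<ℓ r≤q)))

          off-q : w ∉ q → ¬ Deleted F w t → ¬ Deleted F z w → ⊥
          off-q w∉q wt-kept zw-kept with prefix Wq z∈q
          ... | r , Wr , r≤q =
            noShortWalk (snoc (snoc Wr vw zw-adj zw-kept) vt (N-adj w∈N) wt-kept)
              (subst (_≤ℕ suc ℓ) (sym length-rwt) (twoMore q<ℓ r≤q))
            where
            zw-adj : Adj G z w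
            zw-adj = adj⇐ (walk-V Wq z∈q) vw (λ { refl → w∉q z∈q }) zw

            length-rwt : length ((r ++ [ w ]) ++ [ t ]) ≡ suc (suc (length r))
            length-rwt = subst (λ k → length ((r ++ [ w ]) ++ [ t ]) ≡ suc k)
                               (length-snoc r w) (length-snoc (r ++ [ w ]) t)

      -- q runs from an interval starting before b s to t: prepending s, w to a
      -- suffix of q would give a short s-t walk.
      sDegree : ∀ {y q} → Walk G F y t q → b y ≤ℚ b s → suc (length q) ≤ℕ ℓ →
                (N : List (Fin n)) → Unique N → (∀ {w} → w ∈ N → Adj G s w × b w ≤ℚ e t) →
                length N ≤ℕ length F
      sDegree {q = q} Wq by≤bs q<ℓ N N-unique N-adj =
        chargeBound N N-unique (λ w∈N w≡s → adj-irrefl (proj₁ (N-adj w∈N)) (sym w≡s)) paid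
        where
        open Charge F s q

        paid : ∀ {w} → w ∈ N → PaidFor w
        paid {w} w∈N with N-adj w∈N
        ... | sw-adj , bw≤et with adj⇒ sw-adj
        ...   | vs , vw , _ , bs≤ew , _ with cover Wq (ℚP.≤-trans by≤bs bs≤ew) bw≤et
        ...     | z , z∈q , (bz≤ew , bw≤ez) = paidFor z∈q on-q off-q
          where
          on-q : w ∈ q → ¬ Deleted F w s → ⊥
          on-q w∈q ws-kept with suffix Wq w∈q
          ... | r , Wr , r≤q , _ =
            noShortWalk (step vs sw-adj (ws-kept ∘ deleted-sym) Wr)
              (ℕP.m+n≤o⇒n≤o 1 (twoMore q<ℓ r≤q))

          off-q : w ∉ q → ¬ Deleted F w s → ¬ Deleted F z w → ⊥
          off-q w∉q ws-kept zw-kept with suffix Wq z∈q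
          ... | r , Wr , r≤q , _ =
            noShortWalk (step vs sw-adj (ws-kept ∘ deleted-sym) (step vw wz-adj (zw-kept ∘ deleted-sym) Wr))
              (twoMore q<ℓ r≤q)
            where
            wz-adj : Adj G w z
            wz-adj = adj⇐ vw (walk-V Wq z∈q) (λ { refl → w∉q z∈q }) (bw≤ez , bz≤ew)

  inL? : ∀ s u → Dec (InL b e s u)
  inL? s u = e u ℚP.<? b s

  inR? : ∀ t u → Dec (InR b e t u)
  inR? t u = e t ℚP.<? b u

  -- With b s < b t, interval t does not end before s starts: s ∉ R and t ∉ L.
  et≮bs : ∀ {s t} → b s <ℚ b t → ¬ (e t <ℚ b s)
  et≮bs {s} {t} bs<bt et<bs = ≤⇒≯ (b≤e t) (ℚP.<-trans et<bs bs<bt)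

  distinct : ∀ {s t} → b s <ℚ b t → s ≢ t
  distinct bs<bt refl = ℚP.<-irrefl refl bs<bt

  -- Adding back R.  A surviving short path in G - F leaves V ∖ R along an edge
  -- from some x to r ∈ R, so e t < b r ≤ e x; its part up to x is charged by tDegree.
  restoreR : ∀ {G s t β ℓ} → IntervalSubgraph G → b s <ℚ b t →
            LBCYes (induced G (λ u → ¬ InR b e t u)) s t β ℓ → LBCYes G s t β ℓ
  restoreR {G} {s} {t} {ℓ = ℓ} IG bs<bt (F , F-edges , F≤β , F-cuts) =
    starOrCut (distinct {s} {t} bs<bt) F
      (edgeSet-induced {G = G} {Z = λ u → ¬ InR b e t u} F-edges) F≤β (inj₂ ∘ tBound)
    where
    open OnSubgraph IG
    notR? : ∀ u → Dec (¬ InR b e t u)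
    notR? u = ¬? (inR? t u)
    open OnSubgraph.DegreeBounds (induced-subgraph IG notR?) F-cuts

    tBound : ShortPath G F s t ℓ → length (nbrs t) ≤ℕ length F
    tBound (p , W , _ , p≤ℓ) with firstExit notR? (et≮bs bs<bt) (≤⇒≯ (b≤e t)) W
    ... | inj₁ W′ = ⊥-elim (noShortWalk W′ p≤ℓ)
    ... | inj₂ (x , r , q , Wq , ¬¬Rr , xr , q<p) =
          tDegree bs<bt Wq et≤ex (ℕP.≤-pred (ℕP.≤-trans q<p p≤ℓ)) (nbrs t) (nbrs-unique t) nbr-adj
      where
      et≤ex : e t ≤ℚ e x
      et≤ex = ℚP.<⇒≤ (ℚP.<-≤-trans (decidable-stable (inR? t r) ¬¬Rr)
                                   (proj₂ (adj⇒intersect xr)))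

      nbr-adj : ∀ {w} → w ∈ nbrs t → Adj (induced G (λ u → ¬ InR b e t u)) w t
      nbr-adj w∈N = let wt = adj-sym (∈nbrs⇒adj w∈N)
                        (_ , _ , _ , bw≤et , _) = adj⇒ wt in
                    ≤⇒≯ bw≤et , ≤⇒≯ (b≤e t) , wt

  -- A surviving short path in G - F re-enters V ∖ L for the last
  -- time along an edge from some u′ ∈ L to y, so b y ≤ e u′ < b s; its part from y
  -- is charged to s by sDegree, unless s has a neighbour in R, in which case s
  -- alone covers the neighbours of t and tDegree applies.
  restoreL : ∀ {G s t β ℓ} → IntervalSubgraph G → V G s → b s <ℚ b t →
            LBCYes (induced G (λ u → ¬ InL b e s u)) s t β ℓ → LBCYes G s t β ℓ
  restoreL {G} {s} {t} {ℓ = ℓ} IG vs bs<bt (F , F-edges , F≤β , F-cuts) =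
    starOrCut (distinct {s} {t} bs<bt) F
      (edgeSet-induced {G = G} {Z = λ u → ¬ InL b e s u} F-edges) F≤β degreeBound
    where
    open OnSubgraph IG
    notL? : ∀ u → Dec (¬ InL b e s u)
    notL? u = ¬? (inL? s u)
    open OnSubgraph.DegreeBounds (induced-subgraph IG notL?) F-cuts

    degreeBound : ShortPath G F s t ℓ → length (nbrs s) ≤ℕ length F ⊎ length (nbrs t) ≤ℕ length F
    degreeBound (p , W , _ , p≤ℓ) with lastExit notL? (≤⇒≯ (b≤e s)) (et≮bs bs<bt) W
    ... | inj₁ W′ = ⊥-elim (noShortWalk W′ p≤ℓ)
    ... | inj₂ (u′ , y , q , ¬¬Lu′ , u′y , Wq , q<p) with any? (inR? t) (nbrs s)
    ...   | yes s-meets-R =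
            inj₂ (tDegree bs<bt (here (vs , ≤⇒≯ (b≤e s))) et≤es 2≤ℓ (nbrs t) (nbrs-unique t) nbr-adj)
      where
      et≤es : e t ≤ℚ e s
      et≤es with find s-meets-R
      ... | r , r∈N , et<br =
            ℚP.<⇒≤ (ℚP.<-≤-trans et<br (proj₂ (adj⇒intersect (∈nbrs⇒adj r∈N))))

      2≤ℓ : 2 ≤ℕ ℓ
      2≤ℓ = ℕP.≤-trans (s≤s (nonempty Wq)) (ℕP.≤-pred (ℕP.≤-trans q<p p≤ℓ))

      nbr-adj : ∀ {w} → w ∈ nbrs t → Adj (induced G (λ u → ¬ InL b e s u)) w t
      nbr-adj w∈N = let wt = adj-sym (∈nbrs⇒adj w∈N)
                        (_ , _ , _ , _ , bt≤ew) = adj⇒ wt in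
                    ≤⇒≯ (ℚP.<⇒≤ (ℚP.<-≤-trans bs<bt bt≤ew)) , et≮bs bs<bt , wt
    ...   | no s-misses-R =
            inj₁ (sDegree Wq by≤bs (ℕP.≤-pred (ℕP.≤-trans q<p p≤ℓ)) (nbrs s) (nbrs-unique s) nbr-adj)
      where
      by≤bs : b y ≤ℚ b s
      by≤bs = ℚP.<⇒≤ (ℚP.≤-<-trans (proj₂ (adj⇒intersect u′y))
                                   (decidable-stable (inL? s u′) ¬¬Lu′))

      nbr-adj : ∀ {w} → w ∈ nbrs s → Adj (induced G (λ u → ¬ InL b e s u)) s w × b w ≤ℚ e t
      nbr-adj w∈N = let sw = ∈nbrs⇒adj w∈N
                        (_ , _ , _ , bs≤ew , _) = adj⇒ sw in
                    (≤⇒≯ (b≤e s) , ≤⇒≯ bs≤ew , sw) , ℚP.≮⇒≥ (s-misses-R ∘ lose w∈N)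

lemma33 : (n : ℕ) (b e : Fin n → ℚ) → (∀ v → b v ≤ℚ e v) →
          (s t : Fin n) (β ℓ : ℕ) → 1 ≤ℕ β → 1 ≤ℕ ℓ → b s <ℚ b t →
          LBCYes (intervalGraph b e) s t β ℓ
            ⇔ LBCYes (induced (intervalGraph b e) (λ u → ¬ (InL b e s u ⊎ InR b e t u))) s t β ℓ
lemma33 n b e b≤e s t β ℓ _ _ bs<bt =
  mk⇔ (restrict G₀ (λ u → ¬? (inL? s u ⊎-dec inR? t u)))
      (restoreL intervalGraph-subgraph tt bs<bt ∘ restoreR G₁-subgraph bs<bt ∘ reassociate)
  where
  open Interval b e b≤e
  G₀ G₁ : Graph n
  G₀ = intervalGraph b e
  G₁ = induced G₀ (λ u → ¬ InL b e s u)

  G₁-subgraph : IntervalSubgraph G₁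
  G₁-subgraph = induced-subgraph intervalGraph-subgraph (λ u → ¬? (inL? s u))

  split : ∀ {u} → ¬ (InL b e s u ⊎ InR b e t u) → ¬ InL b e s u × ¬ InR b e t u
  split notLR = notLR ∘ inj₁ , notLR ∘ inj₂

  join : ∀ {u} → ¬ InL b e s u → ¬ InR b e t u → ¬ (InL b e s u ⊎ InR b e t u)
  join notL notR = [ notL , notR ]′

  reassociate : LBCYes (induced G₀ (λ u → ¬ (InL b e s u ⊎ InR b e t u))) s t β ℓ →
                LBCYes (induced G₁ (λ u → ¬ InR b e t u)) s t β ℓ
  reassociate = transfer _ _
    (λ (_ , notLR) → (tt , proj₁ (split notLR)) , proj₂ (split notLR))
    (λ ((_ , notL) , notR) → tt , join notL notR)
    (λ (xu , xv , a) → proj₂ (split xu) , proj₂ (split xv) , proj₁ (split xu) , proj₁ (split xv) , a)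
    (λ (ru , rv , lu , lv , a) → join lu ru , join lv rv , a)
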